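{- Let $H$ be a hypergraph, $\mathbf{t}=(T,\mathrm{bag})$ a rooted tree decomposition of $H$, $F$ an elimination forest of $H$, and $x\in V(T)$. Then the number of context factors in the characteristic factorisation $\mathrm{CF}_{\mathbf{t},F}(x)$ that are not subsets of $\mathrm{mrg}(x)$ is at most $\mathrm{mir}(\mathbf{t},F)\cdot\mathrm{split}(\mathbf{t},F)+3\cdot\mathrm{split}(\mathbf{t},F)$.
   Context: Hypergraph: finite vertex set, edges non-empty subsets. Rooted tree decomposition $\mathbf{t}=(T,\mathrm{bag})$: rooted tree $T$, every edge contained in a bag, each vertex's bags forming a connected subtree. $\mathrm{adh}(x)=\mathrm{bag}(x)\cap\mathrm{bag}(\text{parent of }x)$ ($\emptyset$ at root), $\mathrm{mrg}(x)=\mathrm{bag}(x)\setminus\mathrm{adh}(x)$, $\mathrm{cmp}(x)=\bigcup_{y\text{ descendant of }x}\mathrm{mrg}(y)$. Elimination forest $F$: rooted forest on $V(H)$ where vertices of a common edge are in ancestor–descendant relation. Factors ($F_u$ = descendants of $u$ incl. $u$): tree factor $F_u$; forest factor = non-empty union of tree factors with sibling roots; context factor $F_u\setminus Y$, $Y$ a forest factor with roots strict descendants of $u$. $\mathrm{MF}_F(U)$ = inclusion-maximal factors contained in $U$; $U$ well-formed if $\mathrm{MF}_F(U)$ has no context factor. $\mathrm{split}(\mathbf{t},F)=\max_x|\mathrm{MF}_F(\mathrm{cmp}(x))|$; $\mathrm{mir}(\mathbf{t},F)$ = max over nodes $x$ of the number of children $y$ with $\mathrm{cmp}(y)$ not well-formed.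 The characteristic partition $\mathrm{CP}(x)$ is the family of non-empty sets among $\mathrm{mrg}(x)$, $V(H)\setminus\mathrm{cmp}(x)$ and $\mathrm{cmp}(y)$ for children $y$ of $x$; the characteristic factorisation is $\mathrm{CF}_{\mathbf{t},F}(x)=\bigcup_{U\in\mathrm{CP}(x)}\mathrm{MF}_F(U)$. -}

module Defs where

open import Data.Nat using (ℕ; _≤_; _+_; _*_)
open import Data.Fin using (Fin)
open import Data.Fin.Subset as S using (Subset; Nonempty)
open import Data.Maybe using (Maybe; just; nothing)
open import Data.List using (List; length)
open import Data.List.Relation.Unary.All using (All)
open import Data.List.Relation.Unary.Unique.Propositional using (Unique)
import Data.List.Membership.Propositional as LM
open import Data.Product using (Σ; ∃; ∃-syntax; _×_; _,_)
open import Data.Sum using (_⊎_)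
open import Data.Empty using (⊥)
open import Relation.Nullary using (¬_)
open import Relation.Binary.PropositionalEquality using (_≡_; _≢_)

HasCard : {A : Set} → (A → Set) → ℕ → Set
HasCard {A} P k =
  Σ (List A) λ L → Unique L × All P L × (∀ a → P a → a LM.∈ L) × length L ≡ k

data Desc {k : ℕ} (par : Fin k → Maybe (Fin k)) (u : Fin k) : Fin k → Set where
  here : Desc par u u
  up   : ∀ {v w} → par v ≡ just w → Desc par u w → Desc par u v

data Reaches {k : ℕ} (par : Fin k → Maybe (Fin k)) : Fin k → Set where
  isRoot : ∀ {v} → par v ≡ nothing → Reaches par v
  step   : ∀ {v w} → par v ≡ just w → Reaches par w → Reaches par v

record Hypergraph (n : ℕ) : Set where
  field
    edges    : List (Subset n)
    nonempty : All Nonempty edges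
open Hypergraph public

record ElimForest {n : ℕ} (H : Hypergraph n) : Set where
  field
    fpar    : Fin n → Maybe (Fin n)
    acyclic : ∀ v → Reaches fpar v
    edgeOK  : ∀ e → e LM.∈ edges H → ∀ u v → u S.∈ e → v S.∈ e →
              Desc fpar u v ⊎ Desc fpar v u
open ElimForest public

TAdj : {m : ℕ} → (Fin m → Maybe (Fin m)) → Fin m → Fin m → Set
TAdj par x z = par x ≡ just z ⊎ par z ≡ just x

data Walk {m : ℕ} (par : Fin m → Maybe (Fin m)) (P : Fin m → Set) : Fin m → Fin m → Set where
  nil  : ∀ {x} → Walk par P x x
  cons : ∀ {x z y} → TAdj par x z → P z → Walk par P z y → Walk par P x y

Connected : {m : ℕ} → (Fin m → Maybe (Fin m)) → (Fin m → Set) → Set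
Connected par P = (∃ λ x → P x) × (∀ x y → P x → P y → Walk par P x y)

record TreeDec {n : ℕ} (H : Hypergraph n) (m : ℕ) : Set where
  field
    tpar     : Fin m → Maybe (Fin m)
    root     : Fin m
    rootNoP  : tpar root ≡ nothing
    rooted   : ∀ x → Desc tpar root x
    bag      : Fin m → Subset n
    covers   : ∀ e → e LM.∈ edges H → ∃ λ x → e S.⊆ bag x
    connect  : ∀ v → Connected tpar (λ x → v S.∈ bag x)
open TreeDec public

VSet : ℕ → Set₁
VSet n = Fin n → Set

module _ {n m : ℕ} {H : Hypergraph n} (t : TreeDec H m) where

  adh : Fin m → VSet n
  adh x v with tpar t x
  ... | nothing = ⊥
  ... | just p  = v S.∈ bag t x × v S.∈ bag t p

  mrg : Fin m → VSet n
  mrg x v = v S.∈ bag t x × ¬ adh x v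

  cmp : Fin m → VSet n
  cmp x v = ∃ λ y → Desc (tpar t) x y × mrg y v

module _ {n : ℕ} (fpar : Fin n → Maybe (Fin n)) where

  IsTreeFactor : Subset n → Set
  IsTreeFactor X = ∃ λ u → ∀ v → (v S.∈ X → Desc fpar u v) × (Desc fpar u v → v S.∈ X)

  IsForestFactorWith : Subset n → Subset n → Set
  IsForestFactorWith R X =
    Nonempty R ×
    (∃ λ (p : Maybe (Fin n)) → ∀ r → r S.∈ R → fpar r ≡ p) ×
    (∀ v → (v S.∈ X → ∃ λ r → r S.∈ R × Desc fpar r v) ×
           ((∃ λ r → r S.∈ R × Desc fpar r v) → v S.∈ X))

  IsForestFactor : Subset n → Set
  IsForestFactor X = ∃ λ R → IsForestFactorWith R X

  IsContextFactor : Subset n → Set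
  IsContextFactor X =
    ∃ λ u → ∃ λ R → ∃ λ Y →
      IsForestFactorWith R Y ×
      (∀ r → r S.∈ R → Desc fpar u r × r ≢ u) ×
      (∀ v → (v S.∈ X → Desc fpar u v × ¬ v S.∈ Y) ×
             (Desc fpar u v × ¬ v S.∈ Y → v S.∈ X))

  IsFactor : Subset n → Set
  IsFactor X = IsTreeFactor X ⊎ IsForestFactor X ⊎ IsContextFactor X

  SubsetOf : Subset n → VSet n → Set
  SubsetOf X U = ∀ v → v S.∈ X → U v

  InMF : VSet n → Subset n → Set
  InMF U X = IsFactor X × SubsetOf X U ×
             (∀ Y → IsFactor Y → X S.⊆ Y → SubsetOf Y U → Y ≡ X)

  WellFormed : VSet n → Set
  WellFormed U = ∀ X → InMF U X → ¬ IsContextFactor X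

module _ {n m : ℕ} {H : Hypergraph n} (t : TreeDec H m) (F : ElimForest H) where

  private
    fp = fpar F

  IsSplit : ℕ → Set
  IsSplit s =
    (∀ x → ∃ λ k → HasCard (InMF fp (cmp t x)) k × k ≤ s) ×
    (∃ λ x → HasCard (InMF fp (cmp t x)) s)

  NonWFChild : Fin m → Fin m → Set
  NonWFChild x y = tpar t y ≡ just x × ¬ WellFormed fp (cmp t y)

  IsMir : ℕ → Set
  IsMir M =
    (∀ x → ∃ λ k → HasCard (NonWFChild x) k × k ≤ M) ×
    (∃ λ x → HasCard (NonWFChild x) M)

  -- X ∈ CF_{t,F}(x): X ∈ MF_F(U) for some non-empty U ∈ CP(x)
  InCF : Fin m → Subset n → Set
  InCF x X =
    ((∃ λ v → mrg t x v) × InMF fp (mrg t x) X) ⊎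
    ((∃ λ v → ¬ cmp t x v) × InMF fp (λ v → ¬ cmp t x v) X) ⊎
    (∃ λ y → tpar t y ≡ just x × (∃ λ v → cmp t y v) × InMF fp (cmp t y) X)

  CountedCtx : Fin m → Subset n → Set
  CountedCtx x X = InCF x X × IsContextFactor fp X × ¬ SubsetOf fp X (mrg t x)

-- Let U = cmp(x) and W its complement. A counted context factor X of CF(x) cannot come from
-- mrg(x). If it comes from cmp(y) for a child y, then cmp(y) is not well-formed, so y is one of
-- at most mir children and X one of at most split factors of MF(cmp y). Otherwise X is maximal in
-- W, say X = F_u ∖ (F_r₁ ∪ … ∪ F_rₖ). Maximality forces every root rᵢ to have a descendant in U,
-- and k ≥ 2 unless some root lies in U. Charge X to a factor A ∈ MF(U): the one containing a root
-- in U if there is one, and otherwise the one containing the end of the canonical descent into U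
-- from the larger of two roots. The parent of the topmost vertices of A then recovers the common
-- parent of the roots of X, and two maximal context factors of W with sibling roots coincide,
-- because their union is again a factor inside W. Each factor of MF(U) is charged at most twice,
-- so there are at most 2·split + mir·split counted factors.

module Submission where

open import Defs
open import Data.Nat using (ℕ; _≤_; _+_; _*_)
open import Data.Fin using (Fin)
open import Data.Fin.Subset using (Subset)
open import Data.List using (List; length)
open import Data.List.Relation.Unary.All using (All)
open import Data.List.Relation.Unary.Unique.Propositional using (Unique)

open import Level using (0ℓ)
open import Function using (_∘_)
open import Data.Bool using (true)
open import Data.Empty using (⊥-elim)
open import Data.Product using (Σ; ∃; _×_; _,_; proj₁; proj₂)
open import Data.Sum using (_⊎_; inj₁; inj₂; [_,_])
open import Data.Maybe using (Maybe; just)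
import Data.Maybe.Properties as Maybe
open import Data.Maybe.Properties using (just-injective)
import Data.Nat as ℕ
open import Data.Nat using (_≤?_)
open import Data.Nat.Properties
  using (≤-trans; ≤-reflexive; ≮⇒≥; <⇒≱; +-mono-≤; +-monoʳ-≤; *-monoˡ-≤; +-assoc; +-comm; m≤m+n;
         module ≤-Reasoning)
import Data.Fin as Fin
open import Data.Fin.Properties using (_≟_; any?; ≤-antisym; <-cmp)
open import Data.Fin.Induction using (<-wellFounded)
open import Data.Fin.Subset using (_∈_; _∉_; _⊆_; _⊂_; _⊃_; _∪_; _∩_; ⁅_⁆)
open import Data.Fin.Subset.Properties
  using (_∈?_; nonempty?; ⊆-antisym; x∈⁅x⁆; x∈⁅y⁆⇒x≡y; x∈p∩q⁻; x∈p∩q⁺; x∈p∪q⁻; x∈p∪q⁺;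
         p⊆p∪q; q⊆p∪q)
open import Data.Fin.Subset.Induction using (⊂-wellFounded; ⊃-wellFounded)
open import Data.Vec using (tabulate)
open import Data.Vec.Properties using (lookup∘tabulate; lookup⇒[]=; []=⇒lookup)
open import Data.List using (_++_; _∷_; []; map; concatMap)
open import Data.List.Properties using (length-++-sucʳ; length-++; length-map)
import Data.List.Relation.Unary.All as All
open import Data.List.Relation.Unary.All using (_∷_; [])
open import Data.List.Relation.Unary.Any using (here; there)
open import Data.List.Relation.Unary.Unique.Propositional using (_∷_; [])
open import Data.List.Membership.Propositional using () renaming (_∈_ to _∈ₗ_)
open import Data.List.Membership.Propositional.Properties
  using (∈-∃++; ∈-++⁻; ∈-++⁺ˡ; ∈-++⁺ʳ; ∈-map⁺; ∈-concat⁺′)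
open import Effect.Monad using (RawMonad)
open import Induction.WellFounded using (Acc; acc)
open import Relation.Binary using (tri<; tri≈; tri>)
open import Relation.Binary.PropositionalEquality
  using (_≡_; _≢_; refl; sym; trans; cong; cong₂; subst; module ≡-Reasoning)
open import Relation.Nullary using (¬_; ¬?; Dec; yes; no; does; contradiction; _×-dec_)
open import Relation.Nullary.Negation using (¬¬-Monad)
open import Relation.Nullary.Decidable using (dec-true; decidable-stable; ¬¬-excluded-middle)

open RawMonad (¬¬-Monad {0ℓ})

¬¬-em : (A : Set) → ¬ ¬ Dec A
¬¬-em A = ¬¬-excluded-middle

CoveredBy : {A B : Set} → (A → B → Set) → List B → A → Set
CoveredBy R ys a = ∃ λ b → b ∈ₗ ys × R a b

module _ {A B : Set} (R : A → B → Set)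
         (R-injective : ∀ {a a′ b} → R a b → R a′ b → a ≡ a′) where

  length-≤-of-injective-cover : ∀ {xs} ys → Unique xs → All (CoveredBy R ys) xs →
                                length xs ≤ length ys
  length-≤-of-injective-cover ys [] [] = ℕ.z≤n
  length-≤-of-injective-cover {a ∷ _} ys (a∉xs ∷ xs-unique) ((b , b∈ys , Rab) ∷ covered)
    with ys₁ , ys₂ , refl ← ∈-∃++ b∈ys =
    ≤-trans (ℕ.s≤s (length-≤-of-injective-cover (ys₁ ++ ys₂) xs-unique
                      (All.zipWith uncover (a∉xs , covered))))
            (≤-reflexive (sym (length-++-sucʳ ys₁ b ys₂)))
    where
    remove : ∀ {b′} → b′ ∈ₗ ys₁ ++ b ∷ ys₂ → b′ ≢ b → b′ ∈ₗ ys₁ ++ ys₂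
    remove b′∈ b′≢b with ∈-++⁻ ys₁ b′∈
    ... | inj₁ b′∈ys₁         = ∈-++⁺ˡ b′∈ys₁
    ... | inj₂ (here b′≡b)    = contradiction b′≡b b′≢b
    ... | inj₂ (there b′∈ys₂) = ∈-++⁺ʳ ys₁ b′∈ys₂

    uncover : ∀ {a′} → a ≢ a′ × CoveredBy R (ys₁ ++ b ∷ ys₂) a′ → CoveredBy R (ys₁ ++ ys₂) a′
    uncover (a≢a′ , b′ , b′∈ , Ra′b′) =
      b′ , remove b′∈ (λ { refl → a≢a′ (R-injective Rab Ra′b′) }) , Ra′b′

toSubset : ∀ {n} {P : Fin n → Set} → (∀ v → Dec (P v)) → Subset n
toSubset P? = tabulate (does ∘ P?)

module _ {n : ℕ} {P : Fin n → Set} (P? : ∀ v → Dec (P v)) where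

  ∈-toSubset⁺ : ∀ {v} → P v → v ∈ toSubset P?
  ∈-toSubset⁺ {v} Pv = lookup⇒[]= v _ (trans (lookup∘tabulate _ v) (dec-true (P? v) Pv))

  ∈-toSubset⁻ : ∀ {v} → v ∈ toSubset P? → P v
  ∈-toSubset⁻ {v} v∈ = does-true (P? v) (trans (sym (lookup∘tabulate _ v)) ([]=⇒lookup v∈))
    where
    does-true : ∀ {A : Set} (A? : Dec A) → does A? ≡ true → A
    does-true (yes a) _ = a

⊆∧⊄⇒≡ : ∀ {n} {X Y : Subset n} → X ⊆ Y → ¬ X ⊂ Y → Y ≡ X
⊆∧⊄⇒≡ {X = X} X⊆Y X⊄Y =
  ⊆-antisym (λ {v} v∈Y → decidable-stable (v ∈? X) λ v∉X → X⊄Y (X⊆Y , v , v∈Y , v∉X)) X⊆Y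

least-witness : ∀ {n} (P : Fin n → Set) {c} → P c → ¬ ¬ (∃ λ c → P c × ∀ c′ → P c′ → c Fin.≤ c′)
least-witness P {c} = go (<-wellFounded c)
  where
  go : ∀ {c} → Acc Fin._<_ c → P c → ¬ ¬ (∃ λ c → P c × ∀ c′ → P c′ → c Fin.≤ c′)
  go {c} (acc smaller) Pc = do
    yes (c′ , Pc′ , c′<c) ← ¬¬-em (∃ λ c′ → P c′ × c′ Fin.< c)
      where no none → pure (c , Pc , λ c′ Pc′ → ≮⇒≥ λ c′<c → none (c′ , Pc′ , c′<c))
    go (smaller c′<c) Pc′

module Forest {n : ℕ} (par : Fin n → Maybe (Fin n)) (acyclic : ∀ v → Reaches par v) where

  infix 4 _≼_
  _≼_ : Fin n → Fin n → Set
  u ≼ v = Desc par u v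

  ≼-trans : ∀ {a b c} → a ≼ b → b ≼ c → a ≼ c
  ≼-trans a≼b here       = a≼b
  ≼-trans a≼b (up e b≼w) = up e (≼-trans a≼b b≼w)

  parent-≼ : ∀ {c w} → par c ≡ just w → w ≼ c
  parent-≼ e = up e here

  parent-⋠ : ∀ {v w} → par v ≡ just w → ¬ v ≼ w
  parent-⋠ {v} = go (acyclic v)
    where
    go : ∀ {v w} → Reaches par v → par v ≡ just w → ¬ v ≼ w
    go (isRoot e₀) e _ = contradiction (trans (sym e₀) e) λ ()
    go (step e′ r) e v≼w with refl ← just-injective (trans (sym e′) e) with v≼w
    ... | here       = go r e here
    ... | up e₂ v≼w₂ = go r e₂ (≼-trans (parent-≼ e) v≼w₂)

  ≼-antisym : ∀ {a b} → a ≼ b → b ≼ a → a ≡ b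
  ≼-antisym here       _   = refl
  ≼-antisym (up e a≼w) b≼a = ⊥-elim (parent-⋠ e (≼-trans b≼a a≼w))

  ≼-comparable : ∀ {a b z} → a ≼ z → b ≼ z → a ≼ b ⊎ b ≼ a
  ≼-comparable here       b≼z  = inj₂ b≼z
  ≼-comparable (up e a≼w) here = inj₁ (up e a≼w)
  ≼-comparable (up e a≼w) (up e′ b≼w′) with refl ← just-injective (trans (sym e) e′) =
    ≼-comparable a≼w b≼w′

  child-toward : ∀ {a b} → a ≼ b → b ≢ a → ∃ λ c → par c ≡ just a × c ≼ b
  child-toward here                b≢a = contradiction refl b≢a
  child-toward {b = b} (up e here) _   = b , e , here
  child-toward (up e (up e′ a≼w′)) _   =
    let c , ec , c≼w = child-toward (up e′ a≼w′) λ { refl → parent-⋠ e′ a≼w′ }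
    in  c , ec , ≼-trans c≼w (parent-≼ e)

  parent-exists : ∀ {a b} → a ≼ b → b ≢ a → ∃ λ w → par b ≡ just w
  parent-exists here     b≢a = contradiction refl b≢a
  parent-exists (up e _) _   = _ , e

  ≼-parent : ∀ {a b w} → a ≼ b → b ≢ a → par b ≡ just w → a ≼ w
  ≼-parent here       b≢a _  = contradiction refl b≢a
  ≼-parent (up e a≼w) _   e′ with refl ← just-injective (trans (sym e) e′) = a≼w

  sibling-ancestors-≡ : ∀ {r r′ v} → r ≼ v → r′ ≼ v → par r ≡ par r′ → r ≡ r′
  sibling-ancestors-≡ r≼v r′≼v p =
    [ (λ r≼r′ → ancestor-sibling r≼r′ p) , (λ r′≼r → sym (ancestor-sibling r′≼r (sym p))) ]
      (≼-comparable r≼v r′≼v)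
    where
    ancestor-sibling : ∀ {r r′} → r ≼ r′ → par r ≡ par r′ → r ≡ r′
    ancestor-sibling here       _ = refl
    ancestor-sibling (up e r≼w) p = ⊥-elim (parent-⋠ (trans p e) r≼w)

  _≼?_ : ∀ u v → Dec (u ≼ v)
  u ≼? v = go (acyclic v)
    where
    go : ∀ {v} → Reaches par v → Dec (u ≼ v)
    go {v} r with v ≟ u
    go r          | yes refl = yes here
    go (isRoot e) | no v≢u   =
      no λ { here → v≢u refl ; (up e′ _) → contradiction (trans (sym e) e′) λ () }
    go (step e r) | no v≢u with go r
    ... | yes u≼w = yes (up e u≼w)
    ... | no u⋠w  = no λ { here → v≢u refl
                         ; (up e′ u≼w′) → u⋠w (subst (u ≼_) (just-injective (trans (sym e′) e)) u≼w′) }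

  parent? : ∀ c w → Dec (par c ≡ just w)
  parent? c w = Maybe.≡-dec _≟_ (par c) (just w)

module Factors {n : ℕ} (fp : Fin n → Maybe (Fin n)) (acyclic : ∀ v → Reaches fp v) where
  open Forest fp acyclic

  descendants : Fin n → Subset n
  descendants r = toSubset (r ≼?_)

  children : Fin n → Subset n
  children w = toSubset (λ c → parent? c w)

  Below : Subset n → Fin n → Set
  Below R v = ∃ λ r → r ∈ R × r ≼ v

  below? : ∀ R v → Dec (Below R v)
  below? R v = any? λ r → r ∈? R ×-dec r ≼? v

  trimmed-isFactor : ∀ {Z} u R p → (∀ r → r ∈ R → fp r ≡ p × u ≼ r × r ≢ u) →
                     (∀ v → v ∈ Z → u ≼ v × ¬ Below R v) →
                     (∀ v → u ≼ v → ¬ Below R v → v ∈ Z) → IsFactor fp Z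
  trimmed-isFactor u R p R-below Z⊆ ⊆Z with nonempty? R
  ... | no R-empty =
    inj₁ (u , λ v → proj₁ ∘ Z⊆ v , λ u≼v → ⊆Z v u≼v λ (r , r∈R , _) → R-empty (r , r∈R))
  ... | yes R-nonempty =
    inj₂ (inj₂ (u , R , toSubset (below? R) , removed-forest , (λ r → proj₂ ∘ R-below r) ,
                λ v → (λ v∈Z → let u≼v , unbelow = Z⊆ v v∈Z in u≼v , unbelow ∘ ∈-toSubset⁻ (below? R)) ,
                      λ (u≼v , v∉Y) → ⊆Z v u≼v (v∉Y ∘ ∈-toSubset⁺ (below? R))))
    where
    removed-forest : IsForestFactorWith fp R (toSubset (below? R))
    removed-forest =
      R-nonempty , (p , λ r → proj₁ ∘ R-below r) , λ v → ∈-toSubset⁻ (below? R) , ∈-toSubset⁺ (below? R)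

  record Context (X : Subset n) : Set where
    field
      apex           : Fin n
      roots removed  : Subset n
      removed-forest : IsForestFactorWith fp roots removed
      roots-below    : ∀ r → r ∈ roots → apex ≼ r × r ≢ apex
      members        : ∀ v → (v ∈ X → apex ≼ v × v ∉ removed) × (apex ≼ v × v ∉ removed → v ∈ X)

    some-root : ∃ λ r → r ∈ roots
    some-root = proj₁ removed-forest

    roots-siblings : ∀ {r r′} → r ∈ roots → r′ ∈ roots → fp r ≡ fp r′
    roots-siblings r∈ r′∈ = let _ , common = proj₁ (proj₂ removed-forest) in
      trans (common _ r∈) (sym (common _ r′∈))

    removed⁻ : ∀ {v} → v ∈ removed → Below roots v
    removed⁻ = proj₁ (proj₂ (proj₂ removed-forest) _)

    removed⁺ : ∀ {v} → Below roots v → v ∈ removed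
    removed⁺ = proj₂ (proj₂ (proj₂ removed-forest) _)

    ∈⇒apex≼ : ∀ {v} → v ∈ X → apex ≼ v
    ∈⇒apex≼ v∈X = proj₁ (proj₁ (members _) v∈X)

    ∈⇒∉removed : ∀ {v} → v ∈ X → v ∉ removed
    ∈⇒∉removed v∈X = proj₂ (proj₁ (members _) v∈X)

    ∈⁺ : ∀ {v} → apex ≼ v → v ∉ removed → v ∈ X
    ∈⁺ apex≼v v∉Y = proj₂ (members _) (apex≼v , v∉Y)

    root-∉ : ∀ {r} → r ∈ roots → r ∉ X
    root-∉ r∈ r∈X = ∈⇒∉removed r∈X (removed⁺ (_ , r∈ , here))

    root-parent-exists : ∀ {r} → r ∈ roots → ∃ λ p → fp r ≡ just p
    root-parent-exists r∈ = let apex≼r , r≢apex = roots-below _ r∈ in parent-exists apex≼r r≢apex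

    apex≼root-parent : ∀ {r p} → r ∈ roots → fp r ≡ just p → apex ≼ p
    apex≼root-parent r∈ = let apex≼r , r≢apex = roots-below _ r∈ in ≼-parent apex≼r r≢apex

    root-parent-∈ : ∀ {r p} → r ∈ roots → fp r ≡ just p → p ∈ X
    root-parent-∈ r∈ e = ∈⁺ (apex≼root-parent r∈ e) λ p∈Y →
      let r′ , r′∈ , r′≼p = removed⁻ p∈Y in parent-⋠ (trans (roots-siblings r′∈ r∈) e) r′≼p

  open Context

  context : ∀ {X} → IsContextFactor fp X → Context X
  context (u , R , Y , forest , R-below , mem) = record
    { apex = u ; roots = R ; removed = Y ; removed-forest = forest
    ; roots-below = R-below ; members = mem }

  ∪-isFactor : ∀ {X₁ X₂} (γ₁ : Context X₁) (γ₂ : Context X₂) {r₁ r₂ p} →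
               r₁ ∈ roots γ₁ → r₂ ∈ roots γ₂ → fp r₁ ≡ just p → fp r₂ ≡ just p →
               apex γ₁ ≼ apex γ₂ → IsFactor fp (X₁ ∪ X₂)
  ∪-isFactor {X₁} {X₂} γ₁ γ₂ {p = p} r₁∈ r₂∈ e₁ e₂ a₁≼a₂ =
    trimmed-isFactor (apex γ₁) (roots γ₁ ∩ roots γ₂) (just p) shared-below ∪⊆ ⊆∪
    where
    parent₁ : ∀ {r} → r ∈ roots γ₁ → fp r ≡ just p
    parent₁ r∈ = trans (roots-siblings γ₁ r∈ r₁∈) e₁

    parent₂ : ∀ {r} → r ∈ roots γ₂ → fp r ≡ just p
    parent₂ r∈ = trans (roots-siblings γ₂ r∈ r₂∈) e₂

    shared-below : ∀ r → r ∈ roots γ₁ ∩ roots γ₂ → fp r ≡ just p × apex γ₁ ≼ r × r ≢ apex γ₁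
    shared-below r r∈ = let r∈₁ , _ = x∈p∩q⁻ _ _ r∈ in parent₁ r∈₁ , roots-below γ₁ r r∈₁

    apex₂≼ : ∀ {r v} → r ∈ roots γ₁ → r ≼ v → apex γ₂ ≼ v
    apex₂≼ r∈₁ r≼v = ≼-trans (apex≼root-parent γ₂ r₂∈ e₂) (≼-trans (parent-≼ (parent₁ r∈₁)) r≼v)

    shared : ∀ {r v} → r ∈ roots γ₁ → r ≼ v → v ∈ removed γ₂ → Below (roots γ₁ ∩ roots γ₂) v
    shared {r} r∈₁ r≼v v∈Y₂ with r′ , r′∈₂ , r′≼v ← removed⁻ γ₂ v∈Y₂
      with refl ← sibling-ancestors-≡ r≼v r′≼v (trans (parent₁ r∈₁) (sym (parent₂ r′∈₂))) =
      r , x∈p∩q⁺ (r∈₁ , r′∈₂) , r≼v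

    ∪⊆ : ∀ v → v ∈ X₁ ∪ X₂ → apex γ₁ ≼ v × ¬ Below (roots γ₁ ∩ roots γ₂) v
    ∪⊆ v v∈ with x∈p∪q⁻ X₁ X₂ v∈
    ... | inj₁ v∈X₁ = ∈⇒apex≼ γ₁ v∈X₁ , λ (r , r∈ , r≼v) →
      ∈⇒∉removed γ₁ v∈X₁ (removed⁺ γ₁ (r , proj₁ (x∈p∩q⁻ _ _ r∈) , r≼v))
    ... | inj₂ v∈X₂ = ≼-trans a₁≼a₂ (∈⇒apex≼ γ₂ v∈X₂) , λ (r , r∈ , r≼v) →
      ∈⇒∉removed γ₂ v∈X₂ (removed⁺ γ₂ (r , proj₂ (x∈p∩q⁻ _ _ r∈) , r≼v))

    ⊆∪ : ∀ v → apex γ₁ ≼ v → ¬ Below (roots γ₁ ∩ roots γ₂) v → v ∈ X₁ ∪ X₂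
    ⊆∪ v a₁≼v unshared with v ∈? removed γ₁
    ... | no v∉Y₁  = x∈p∪q⁺ (inj₁ (∈⁺ γ₁ a₁≼v v∉Y₁))
    ... | yes v∈Y₁ = let r , r∈₁ , r≼v = removed⁻ γ₁ v∈Y₁ in
      x∈p∪q⁺ (inj₂ (∈⁺ γ₂ (apex₂≼ r∈₁ r≼v) (unshared ∘ shared r∈₁ r≼v)))

  module _ {V : Fin n → Set} where

    maximal-∪-≡ : ∀ {X₁ X₂} → InMF fp V X₁ → InMF fp V X₂ → IsFactor fp (X₁ ∪ X₂) → X₁ ≡ X₂
    maximal-∪-≡ {X₁} {X₂} (_ , X₁⊆V , max₁) (_ , X₂⊆V , max₂) ∪-factor =
      trans (sym (max₁ _ ∪-factor (p⊆p∪q X₂) ∪⊆V)) (max₂ _ ∪-factor (q⊆p∪q X₁ X₂) ∪⊆V)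
      where
      ∪⊆V : SubsetOf fp (X₁ ∪ X₂) V
      ∪⊆V v v∈ = [ X₁⊆V v , X₂⊆V v ] (x∈p∪q⁻ X₁ X₂ v∈)

    sibling-roots⇒≡ : ∀ {X₁ X₂} → InMF fp V X₁ → InMF fp V X₂ → (γ₁ : Context X₁) (γ₂ : Context X₂) →
                      ∀ {r₁ r₂ p} → r₁ ∈ roots γ₁ → r₂ ∈ roots γ₂ → fp r₁ ≡ just p → fp r₂ ≡ just p →
                      X₁ ≡ X₂
    sibling-roots⇒≡ m₁ m₂ γ₁ γ₂ r₁∈ r₂∈ e₁ e₂
      with ≼-comparable (apex≼root-parent γ₁ r₁∈ e₁) (apex≼root-parent γ₂ r₂∈ e₂)
    ... | inj₁ a₁≼a₂ = maximal-∪-≡ m₁ m₂ (∪-isFactor γ₁ γ₂ r₁∈ r₂∈ e₁ e₂ a₁≼a₂)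
    ... | inj₂ a₂≼a₁ = sym (maximal-∪-≡ m₂ m₁ (∪-isFactor γ₂ γ₁ r₂∈ r₁∈ e₂ e₁ a₂≼a₁))

    maximal-excludes-root : ∀ {X} → InMF fp V X → (γ : Context X) → ∀ {r} → r ∈ roots γ →
                            ∀ {Z} → IsFactor fp Z → X ⊆ Z → SubsetOf fp Z V → r ∉ Z
    maximal-excludes-root (_ , _ , max) γ r∈ Z-factor X⊆Z Z⊆V r∈Z =
      root-∉ γ r∈ (subst (_ ∈_) (max _ Z-factor X⊆Z Z⊆V) r∈Z)

  -- the parent of the topmost vertices of a factor: those of its root, its roots, or its apex
  exitParent : ∀ {A} → IsFactor fp A → Maybe (Fin n)
  exitParent (inj₁ (t , _))                     = fp t
  exitParent (inj₂ (inj₁ (_ , _ , (p , _) , _))) = p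
  exitParent (inj₂ (inj₂ (u , _)))              = fp u

  exit-parent : ∀ {A} (A-factor : IsFactor fp A) {r q} → r ∈ A → fp r ≡ just q → q ∉ A →
                fp r ≡ exitParent A-factor
  exit-parent (inj₁ (t , mem)) {r} r∈A e q∉A with r ≟ t
  ... | yes refl = refl
  ... | no r≢t   = contradiction (proj₂ (mem _) (≼-parent (proj₁ (mem r) r∈A) r≢t e)) q∉A
  exit-parent (inj₂ (inj₁ (R , _ , (p , common) , mem))) {r} r∈A e q∉A
    with s , s∈R , s≼r ← proj₁ (mem r) r∈A with r ≟ s
  ... | yes refl = common r s∈R
  ... | no r≢s   = contradiction (proj₂ (mem _) (s , s∈R , ≼-parent s≼r r≢s e)) q∉A
  exit-parent (inj₂ (inj₂ (u , R , Y , forest , _ , mem))) {r} r∈A e q∉A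
    with u≼r , r∉Y ← proj₁ (mem r) r∈A with r ≟ u
  ... | yes refl = refl
  ... | no r≢u   = contradiction (proj₂ (mem _) (≼-parent u≼r r≢u e , q∉Y)) q∉A
    where
    q∉Y : _ ∉ Y
    q∉Y q∈Y = let s , s∈R , s≼q = proj₁ (proj₂ (proj₂ forest) _) q∈Y in
      r∉Y (proj₂ (proj₂ (proj₂ forest) r) (s , s∈R , ≼-trans s≼q (parent-≼ e)))

  exit-parents-≡ : ∀ {A} → IsFactor fp A → ∀ {r₁ r₂ q₁ q₂} → r₁ ∈ A → r₂ ∈ A →
                   fp r₁ ≡ just q₁ → fp r₂ ≡ just q₂ → q₁ ∉ A → q₂ ∉ A → q₁ ≡ q₂
  exit-parents-≡ A-factor {r₁} {r₂} {q₁} {q₂} r₁∈ r₂∈ e₁ e₂ q₁∉ q₂∉ = just-injective (begin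
    just q₁             ≡⟨ sym e₁ ⟩
    fp r₁               ≡⟨ exit-parent A-factor r₁∈ e₁ q₁∉ ⟩
    exitParent A-factor ≡⟨ sym (exit-parent A-factor r₂∈ e₂ q₂∉) ⟩
    fp r₂               ≡⟨ e₂ ⟩
    just q₂             ∎)
    where open ≡-Reasoning

  ⁅⁆-isFactor : ∀ z → IsFactor fp ⁅ z ⁆
  ⁅⁆-isFactor z = trimmed-isFactor z (children z) (just z) children-below ⁅z⁆⊆ ⊆⁅z⁆
    where
    children-below : ∀ c → c ∈ children z → fp c ≡ just z × z ≼ c × c ≢ z
    children-below c c∈ = let e = ∈-toSubset⁻ (λ c → parent? c z) c∈ in
      e , parent-≼ e , λ { refl → parent-⋠ e here }

    ⁅z⁆⊆ : ∀ v → v ∈ ⁅ z ⁆ → z ≼ v × ¬ Below (children z) v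
    ⁅z⁆⊆ v v∈ with refl ← x∈⁅y⁆⇒x≡y z v∈ =
      here , λ (c , c∈ , c≼z) → parent-⋠ (∈-toSubset⁻ (λ c → parent? c z) c∈) c≼z

    ⊆⁅z⁆ : ∀ v → z ≼ v → ¬ Below (children z) v → v ∈ ⁅ z ⁆
    ⊆⁅z⁆ v z≼v childless with v ≟ z
    ... | yes refl = x∈⁅x⁆ z
    ... | no v≢z   = let c , e , c≼v = child-toward z≼v v≢z in
      contradiction (c , ∈-toSubset⁺ (λ c → parent? c z) e , c≼v) childless

  module _ (V : Fin n → Set) where

    maximal-factor-⊇ : ∀ {X} → IsFactor fp X → SubsetOf fp X V → ¬ ¬ (∃ λ A → InMF fp V A × X ⊆ A)
    maximal-factor-⊇ = grow (⊃-wellFounded _)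
      where
      grow : ∀ {X} → Acc _⊃_ X → IsFactor fp X → SubsetOf fp X V →
             ¬ ¬ (∃ λ A → InMF fp V A × X ⊆ A)
      grow {X} (acc larger) X-factor X⊆V = do
        yes (Y , Y-factor , Y⊆V , X⊂Y) ← ¬¬-em (∃ λ Y → IsFactor fp Y × SubsetOf fp Y V × X ⊂ Y)
          where no unextendable → pure (X , (X-factor , X⊆V , maximal unextendable) , λ {v} v∈X → v∈X)
        A , A-maximal , Y⊆A ← grow (larger X⊂Y) Y-factor Y⊆V
        pure (A , A-maximal , λ {v} v∈X → Y⊆A (proj₁ X⊂Y v∈X))
        where
        maximal : ¬ (∃ λ Y → IsFactor fp Y × SubsetOf fp Y V × X ⊂ Y) →
                  ∀ Y → IsFactor fp Y → X ⊆ Y → SubsetOf fp Y V → Y ≡ X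
        maximal unextendable Y Y-factor X⊆Y Y⊆V =
          ⊆∧⊄⇒≡ X⊆Y λ X⊂Y → unextendable (Y , Y-factor , Y⊆V , X⊂Y)

    maximal-factor-∋ : ∀ z → V z → ¬ ¬ (∃ λ A → InMF fp V A × z ∈ A)
    maximal-factor-∋ z Vz = do
      A , A-maximal , z⊆A ← maximal-factor-⊇ (⁅⁆-isFactor z)
                               (λ v v∈ → subst V (sym (x∈⁅y⁆⇒x≡y z v∈)) Vz)
      pure (A , A-maximal , z⊆A (x∈⁅x⁆ z))

  descendants-⊂ : ∀ {c r} → fp c ≡ just r → descendants c ⊂ descendants r
  descendants-⊂ {c} {r} e =
    (λ v∈ → ∈-toSubset⁺ (r ≼?_) (≼-trans (parent-≼ e) (∈-toSubset⁻ (c ≼?_) v∈))) ,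
    r , ∈-toSubset⁺ (r ≼?_) here , λ r∈ → parent-⋠ e (∈-toSubset⁻ (c ≼?_) r∈)

  module Complement (U : Fin n → Set) where

    W : Fin n → Set
    W v = ¬ U v

    ReachesU : Fin n → Set
    ReachesU r = ∃ λ y → r ≼ y × U y

    -- Otherwise X ∪ F_r would be a larger factor inside W.
    root-reachesU : ∀ {X} → InMF fp W X → (γ : Context X) → ∀ {r} → r ∈ roots γ → ¬ ¬ ReachesU r
    root-reachesU {X} X-maximal@(_ , X⊆W , _) γ {r} r∈ unreachable =
      maximal-excludes-root X-maximal γ r∈ Z-factor (p⊆p∪q _) Z⊆W
        (q⊆p∪q X _ (∈-toSubset⁺ (r ≼?_) here))
      where
      other? : ∀ r′ → Dec (r′ ∈ roots γ × r′ ≢ r)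
      other? r′ = r′ ∈? roots γ ×-dec ¬? (r′ ≟ r)

      others-below : ∀ r′ → r′ ∈ toSubset other? → fp r′ ≡ fp r × apex γ ≼ r′ × r′ ≢ apex γ
      others-below r′ r′∈ = let r′∈R , _ = ∈-toSubset⁻ other? r′∈ in
        roots-siblings γ r′∈R r∈ , roots-below γ r′ r′∈R

      Z⊆ : ∀ v → v ∈ X ∪ descendants r → apex γ ≼ v × ¬ Below (toSubset other?) v
      Z⊆ v v∈ with x∈p∪q⁻ X _ v∈
      ... | inj₁ v∈X = ∈⇒apex≼ γ v∈X , λ (r′ , r′∈ , r′≼v) →
        ∈⇒∉removed γ v∈X (removed⁺ γ (r′ , proj₁ (∈-toSubset⁻ other? r′∈) , r′≼v))
      ... | inj₂ v∈F = let r≼v = ∈-toSubset⁻ (r ≼?_) v∈F in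
        ≼-trans (proj₁ (roots-below γ r r∈)) r≼v , λ (r′ , r′∈ , r′≼v) →
          let r′∈R , r′≢r = ∈-toSubset⁻ other? r′∈ in
          r′≢r (sibling-ancestors-≡ r′≼v r≼v (roots-siblings γ r′∈R r∈))

      ⊆Z : ∀ v → apex γ ≼ v → ¬ Below (toSubset other?) v → v ∈ X ∪ descendants r
      ⊆Z v apex≼v no-other with v ∈? removed γ
      ... | no v∉Y = x∈p∪q⁺ (inj₁ (∈⁺ γ apex≼v v∉Y))
      ... | yes v∈Y with r′ , r′∈R , r′≼v ← removed⁻ γ v∈Y with r′ ≟ r
      ...   | yes refl = x∈p∪q⁺ (inj₂ (∈-toSubset⁺ (r ≼?_) r′≼v))
      ...   | no r′≢r  = contradiction (r′ , ∈-toSubset⁺ other? (r′∈R , r′≢r) , r′≼v) no-other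

      Z-factor : IsFactor fp (X ∪ descendants r)
      Z-factor = trimmed-isFactor (apex γ) (toSubset other?) (fp r) others-below Z⊆ ⊆Z

      Z⊆W : SubsetOf fp (X ∪ descendants r) W
      Z⊆W v v∈ with x∈p∪q⁻ X _ v∈
      ... | inj₁ v∈X = X⊆W v v∈X
      ... | inj₂ v∈F = λ Uv → unreachable (v , ∈-toSubset⁻ (r ≼?_) v∈F , Uv)

    -- Otherwise X ∪ {r} = F_apex ∖ ⋃ {F_c | c a child of r} would be a larger factor inside W.
    no-lone-root : ∀ {X} → InMF fp W X → (γ : Context X) → ∀ {r} → r ∈ roots γ → W r →
                   ¬ (∀ r′ → r′ ∈ roots γ → r′ ≡ r)
    no-lone-root {X} X-maximal@(_ , X⊆W , _) γ {r} r∈ Wr lone =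
      maximal-excludes-root X-maximal γ r∈ Z-factor (p⊆p∪q _) Z⊆W (q⊆p∪q X _ (x∈⁅x⁆ r))
      where
      child? : ∀ c → Dec (fp c ≡ just r)
      child? c = parent? c r

      apex≼r : apex γ ≼ r
      apex≼r = proj₁ (roots-below γ r r∈)

      children-below : ∀ c → c ∈ children r → fp c ≡ just r × apex γ ≼ c × c ≢ apex γ
      children-below c c∈ = let e = ∈-toSubset⁻ child? c∈ in
        e , ≼-trans apex≼r (parent-≼ e) , λ { refl → parent-⋠ e apex≼r }

      Z⊆ : ∀ v → v ∈ X ∪ ⁅ r ⁆ → apex γ ≼ v × ¬ Below (children r) v
      Z⊆ v v∈ with x∈p∪q⁻ X _ v∈
      ... | inj₁ v∈X = ∈⇒apex≼ γ v∈X , λ (c , c∈ , c≼v) →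
        ∈⇒∉removed γ v∈X (removed⁺ γ (r , r∈ , ≼-trans (parent-≼ (∈-toSubset⁻ child? c∈)) c≼v))
      ... | inj₂ v∈⁅r⁆ with refl ← x∈⁅y⁆⇒x≡y r v∈⁅r⁆ =
        apex≼r , λ (c , c∈ , c≼r) → parent-⋠ (∈-toSubset⁻ child? c∈) c≼r

      ⊆Z : ∀ v → apex γ ≼ v → ¬ Below (children r) v → v ∈ X ∪ ⁅ r ⁆
      ⊆Z v apex≼v childless with v ∈? removed γ
      ... | no v∉Y = x∈p∪q⁺ (inj₁ (∈⁺ γ apex≼v v∉Y))
      ... | yes v∈Y with r′ , r′∈R , r′≼v ← removed⁻ γ v∈Y with refl ← lone r′ r′∈R with v ≟ r′
      ...   | yes refl = x∈p∪q⁺ (inj₂ (x∈⁅x⁆ v))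
      ...   | no v≢r   = let c , e , c≼v = child-toward r′≼v v≢r in
        contradiction (c , ∈-toSubset⁺ child? e , c≼v) childless

      Z-factor : IsFactor fp (X ∪ ⁅ r ⁆)
      Z-factor = trimmed-isFactor (apex γ) (children r) (just r) children-below Z⊆ ⊆Z

      Z⊆W : SubsetOf fp (X ∪ ⁅ r ⁆) W
      Z⊆W v v∈ with x∈p∪q⁻ X _ v∈
      ... | inj₁ v∈X   = X⊆W v v∈X
      ... | inj₂ v∈⁅r⁆ = subst W (sym (x∈⁅y⁆⇒x≡y r v∈⁅r⁆)) Wr

    -- The canonical descent from r into U always steps to the least-index child that reaches U.
    FirstChild : Fin n → Fin n → Set
    FirstChild w c = fp c ≡ just w × ReachesU c × (∀ c′ → fp c′ ≡ just w → ReachesU c′ → c Fin.≤ c′)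

    data Descent : Fin n → Fin n → Set where
      arrive  : ∀ {r} → U r → Descent r r
      descend : ∀ {r c z} → ¬ U r → FirstChild r c → Descent c z → Descent r z

    firstChild-unique : ∀ {w c₁ c₂} → FirstChild w c₁ → FirstChild w c₂ → c₁ ≡ c₂
    firstChild-unique (e₁ , reach₁ , least₁) (e₂ , reach₂ , least₂) =
      ≤-antisym (least₁ _ e₂ reach₂) (least₂ _ e₁ reach₁)

    descent-≼ : ∀ {r z} → Descent r z → r ≼ z
    descent-≼ (arrive _)            = here
    descent-≼ (descend _ (e , _) d) = ≼-trans (parent-≼ e) (descent-≼ d)

    descent-U : ∀ {r z} → Descent r z → U z
    descent-U (arrive Uz)     = Uz
    descent-U (descend _ _ d) = descent-U d

    descent-last : ∀ {r z} → Descent r z → ¬ U r → ∃ λ q → fp z ≡ just q × ¬ U q × FirstChild q z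
    descent-last (arrive Ur)                       ¬Ur = contradiction Ur ¬Ur
    descent-last (descend ¬Ur first (arrive _))    _   = _ , proj₁ first , ¬Ur , first
    descent-last (descend _ _ d@(descend ¬Uc _ _)) _   = descent-last d ¬Uc

    descent-through : ∀ {a b z} → Descent a z → a ≼ b → b ≼ z → b ≢ a →
                      ∃ λ w → fp b ≡ just w × FirstChild w b
    descent-through (arrive _) a≼b b≼a b≢a = contradiction (≼-antisym b≼a a≼b) b≢a
    descent-through {b = b} (descend _ first d) a≼b b≼z b≢a
      with c , e , c≼b ← child-toward a≼b b≢a
      with refl ← sibling-ancestors-≡ (≼-trans c≼b b≼z) (descent-≼ d) (trans e (sym (proj₁ first)))
      with b ≟ c
    ... | yes refl = _ , proj₁ first , first
    ... | no b≢c   = descent-through d c≼b b≼z b≢c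

    descent-exists : ∀ {r} → ReachesU r → ¬ ¬ ∃ (Descent r)
    descent-exists {r} = go (⊂-wellFounded (descendants r))
      where
      go : ∀ {r} → Acc _⊂_ (descendants r) → ReachesU r → ¬ ¬ ∃ (Descent r)
      go {r} (acc smaller) (y , r≼y , Uy) = do
        no ¬Ur ← ¬¬-em (U r)
          where yes Ur → pure (r , arrive Ur)
        let c₀ , e₀ , c₀≼y = child-toward r≼y λ { refl → ¬Ur Uy }
        c , (e , reach) , least ← least-witness (λ c → fp c ≡ just r × ReachesU c) (e₀ , y , c₀≼y , Uy)
        z , d ← go (smaller (descendants-⊂ e)) reach
        pure (z , descend ¬Ur (e , reach , λ c′ e′ reach′ → least c′ (e′ , reach′)) d)

    record RootCharge (X A : Subset n) : Set where
      constructor rootCharge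
      field
        X-maximal : InMF fp W X
        A-maximal : InMF fp U A
        γ         : Context X
        root      : Fin n
        root∈     : root ∈ roots γ
        root∈A    : root ∈ A

    record DescentCharge (X A : Subset n) : Set where
      constructor descentCharge
      field
        X-maximal      : InMF fp W X
        A-maximal      : InMF fp U A
        γ              : Context X
        root other end : Fin n
        root∈          : root ∈ roots γ
        other∈         : other ∈ roots γ
        other<root     : other Fin.< root
        root∉U         : ¬ U root
        other-reachesU : ReachesU other
        descent        : Descent root end
        end∈A          : end ∈ A

    outside : ∀ {A} → InMF fp U A → ∀ {q} → ¬ U q → q ∉ A
    outside (_ , A⊆U , _) ¬Uq q∈A = ¬Uq (A⊆U _ q∈A)

    rootCharge-injective : ∀ {X₁ X₂ A} → RootCharge X₁ A → RootCharge X₂ A → X₁ ≡ X₂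
    rootCharge-injective (rootCharge m₁ mA γ₁ r₁ r₁∈ r₁∈A) (rootCharge m₂ _ γ₂ r₂ r₂∈ r₂∈A)
      with p₁ , e₁ ← root-parent-exists γ₁ r₁∈
      with p₂ , e₂ ← root-parent-exists γ₂ r₂∈
      with refl ← exit-parents-≡ (proj₁ mA) r₁∈A r₂∈A e₁ e₂
                    (outside mA (proj₁ (proj₂ m₁) _ (root-parent-∈ γ₁ r₁∈ e₁)))
                    (outside mA (proj₁ (proj₂ m₂) _ (root-parent-∈ γ₂ r₂∈ e₂))) =
      sibling-roots⇒≡ m₁ m₂ γ₁ γ₂ r₁∈ r₂∈ e₁ e₂

    -- If r₂ ≢ r₁, then r₂ lies on the descent from r₁, so it is the least child of its parent
    -- reaching U; the root r₂′ < r₂ is a sibling reaching U.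
    descent-ancestor⇒≡ : ∀ {X₁ X₂} → InMF fp W X₁ → InMF fp W X₂ → (γ₁ : Context X₁) (γ₂ : Context X₂) →
                          ∀ {r₁ r₂ r₂′ z} → r₁ ∈ roots γ₁ → r₂ ∈ roots γ₂ → r₂′ ∈ roots γ₂ →
                          r₂′ Fin.< r₂ → ReachesU r₂′ → Descent r₁ z → Descent r₂ z → r₁ ≼ r₂ → X₁ ≡ X₂
    descent-ancestor⇒≡ m₁ m₂ γ₁ γ₂ {r₁} {r₂} r₁∈ r₂∈ r₂′∈ r₂′<r₂ reach′ d₁ d₂ r₁≼r₂ with r₂ ≟ r₁
    ... | yes refl = let _ , e = root-parent-exists γ₁ r₁∈ in sibling-roots⇒≡ m₁ m₂ γ₁ γ₂ r₁∈ r₂∈ e e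
    ... | no r₂≢r₁ with _ , e , _ , _ , least ← descent-through d₁ r₁≼r₂ (descent-≼ d₂) r₂≢r₁ =
      contradiction (least _ (trans (roots-siblings γ₂ r₂′∈ r₂∈) e) reach′) (<⇒≱ r₂′<r₂)

    descentCharge-injective : ∀ {X₁ X₂ A} → DescentCharge X₁ A → DescentCharge X₂ A → X₁ ≡ X₂
    descentCharge-injective
      (descentCharge m₁ mA γ₁ r₁ r₁′ z₁ r₁∈ r₁′∈ r₁′<r₁ ¬Ur₁ reach₁ d₁ z₁∈A)
      (descentCharge m₂ _  γ₂ r₂ r₂′ z₂ r₂∈ r₂′∈ r₂′<r₂ ¬Ur₂ reach₂ d₂ z₂∈A)
      with q₁ , e₁ , ¬Uq₁ , first₁ ← descent-last d₁ ¬Ur₁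
      with q₂ , e₂ , ¬Uq₂ , first₂ ← descent-last d₂ ¬Ur₂
      with refl ← exit-parents-≡ (proj₁ mA) z₁∈A z₂∈A e₁ e₂ (outside mA ¬Uq₁) (outside mA ¬Uq₂)
      with refl ← firstChild-unique first₁ first₂
      with ≼-comparable (descent-≼ d₁) (descent-≼ d₂)
    ... | inj₁ r₁≼r₂ = descent-ancestor⇒≡ m₁ m₂ γ₁ γ₂ r₁∈ r₂∈ r₂′∈ r₂′<r₂ reach₂ d₁ d₂ r₁≼r₂
    ... | inj₂ r₂≼r₁ = sym (descent-ancestor⇒≡ m₂ m₁ γ₂ γ₁ r₂∈ r₁∈ r₁′∈ r₁′<r₁ reach₁ d₂ d₁ r₂≼r₁)

    charge : ∀ {X} → InMF fp W X → IsContextFactor fp X →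
             ¬ ¬ (∃ (RootCharge X) ⊎ ∃ (DescentCharge X))
    charge {X} X-maximal X-context = do
      no no-root-in-U ← ¬¬-em (∃ λ r → r ∈ roots γ × U r)
        where yes (r , r∈ , Ur) → do
                A , A-maximal , r∈A ← maximal-factor-∋ U r Ur
                pure (inj₁ (A , rootCharge X-maximal A-maximal γ r r∈ r∈A))
      let r₀ , r₀∈ = some-root γ
      yes (r₁ , r₁∈ , r₁≢r₀) ← ¬¬-em (∃ λ r → r ∈ roots γ × r ≢ r₀)
        where no lone → ⊥-elim (no-lone-root X-maximal γ r₀∈ (λ Ur₀ → no-root-in-U (r₀ , r₀∈ , Ur₀))
                          λ r r∈ → decidable-stable (r ≟ r₀) λ r≢r₀ → lone (r , r∈ , r≢r₀))
      inj₂ <$> distinct-roots no-root-in-U r₁∈ r₀∈ r₁≢r₀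
      where
      γ = context X-context

      ordered-roots : ¬ (∃ λ r → r ∈ roots γ × U r) → ∀ {r r′} → r ∈ roots γ → r′ ∈ roots γ →
                      r′ Fin.< r → ¬ ¬ ∃ (DescentCharge X)
      ordered-roots no-root-in-U {r} {r′} r∈ r′∈ r′<r = do
        reach′ ← root-reachesU X-maximal γ r′∈
        reach  ← root-reachesU X-maximal γ r∈
        z , d  ← descent-exists reach
        A , A-maximal , z∈A ← maximal-factor-∋ U z (descent-U d)
        pure (A , descentCharge X-maximal A-maximal γ r r′ z r∈ r′∈ r′<r
                    (λ Ur → no-root-in-U (r , r∈ , Ur)) reach′ d z∈A)

      distinct-roots : ¬ (∃ λ r → r ∈ roots γ × U r) → ∀ {r r′} → r ∈ roots γ → r′ ∈ roots γ →
                       r ≢ r′ → ¬ ¬ ∃ (DescentCharge X)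
      distinct-roots no-root-in-U {r} {r′} r∈ r′∈ r≢r′ with <-cmp r r′
      ... | tri< r<r′ _ _ = ordered-roots no-root-in-U r′∈ r∈ r<r′
      ... | tri≈ _ r≡r′ _ = contradiction r≡r′ r≢r′
      ... | tri> _ _ r′<r = ordered-roots no-root-in-U r∈ r′∈ r′<r

bounded-cover : ∀ {A : Set} {P : A → Set} {k s} → HasCard P k → k ≤ s →
                Σ (List A) λ xs → (∀ a → P a → a ∈ₗ xs) × length xs ≤ s
bounded-cover (xs , _ , _ , complete , refl) k≤s = xs , complete , k≤s

length-concatMap-≤ : ∀ {A B : Set} (f : A → List B) {s} → (∀ a → length (f a) ≤ s) →
                     ∀ xs → length (concatMap f xs) ≤ length xs * s
length-concatMap-≤ f f≤s []       = ℕ.z≤n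
length-concatMap-≤ f f≤s (a ∷ xs) =
  ≤-trans (≤-reflexive (length-++ (f a))) (+-mono-≤ (f≤s a) (length-concatMap-≤ f f≤s xs))

module Charging {n m : ℕ} {H : Hypergraph n} (t : TreeDec H m) (F : ElimForest H) (x : Fin m)
                (mf : Fin m → List (Subset n))
                (mf-complete : ∀ y A → InMF (fpar F) (cmp t y) A → A ∈ₗ mf y)
                (bad : List (Fin m)) (bad-complete : ∀ y → NonWFChild t F x y → y ∈ₗ bad) where
  open Factors (fpar F) (acyclic F)
  open Complement (cmp t x)

  data Charge : Set where
    viaRoot viaDescent : Subset n → Charge
    viaChild           : Fin m → Subset n → Charge

  Charged : Subset n → Charge → Set
  Charged X (viaRoot A)    = RootCharge X A
  Charged X (viaDescent A) = DescentCharge X A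
  Charged X (viaChild _ A) = X ≡ A

  Charged-injective : ∀ {X₁ X₂ c} → Charged X₁ c → Charged X₂ c → X₁ ≡ X₂
  Charged-injective {c = viaRoot _}    = rootCharge-injective
  Charged-injective {c = viaDescent _} = descentCharge-injective
  Charged-injective {c = viaChild _ _} = λ X₁≡A X₂≡A → trans X₁≡A (sym X₂≡A)

  childCharges : Fin m → List Charge
  childCharges y = map (viaChild y) (mf y)

  charges : List Charge
  charges = map viaRoot (mf x) ++ map viaDescent (mf x) ++ concatMap childCharges bad

  counted-charged : ∀ {X} → CountedCtx t F x X → ¬ ¬ CoveredBy Charged charges X
  counted-charged (inj₁ (_ , _ , X⊆mrg , _) , _ , X⊈mrg) = contradiction X⊆mrg X⊈mrg
  counted-charged (inj₂ (inj₁ (_ , X-maximal)) , X-context , _) =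
    [ (λ (A , ρ) → viaRoot A , ∈-++⁺ˡ (∈-map⁺ viaRoot (mf-complete x A (RootCharge.A-maximal ρ))) , ρ)
    , (λ (A , δ) → viaDescent A ,
                   ∈-++⁺ʳ (map viaRoot (mf x))
                     (∈-++⁺ˡ (∈-map⁺ viaDescent (mf-complete x A (DescentCharge.A-maximal δ)))) , δ)
    ] <$> charge X-maximal X-context
  counted-charged {X} (inj₂ (inj₂ (y , y-child , _ , X-maximal)) , X-context , _) =
    pure (viaChild y X ,
          ∈-++⁺ʳ (map viaRoot (mf x)) (∈-++⁺ʳ (map viaDescent (mf x))
            (∈-concat⁺′ (∈-map⁺ (viaChild y) (mf-complete y X X-maximal))
                        (∈-map⁺ childCharges (bad-complete y y-bad)))) ,
          refl)
    where
    y-bad : NonWFChild t F x y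
    y-bad = y-child , λ wf → wf X X-maximal X-context

  charges-length : ∀ {k s} → length bad ≤ k → (∀ y → length (mf y) ≤ s) →
                   length charges ≤ k * s + 3 * s
  charges-length {k} {s} bad≤k mf≤s = begin
    length charges
      ≡⟨ length-++ (map viaRoot (mf x)) ⟩
    length (map viaRoot (mf x)) + length (map viaDescent (mf x) ++ concatMap childCharges bad)
      ≡⟨ cong₂ _+_ (length-map viaRoot (mf x)) (length-++ (map viaDescent (mf x))) ⟩
    length (mf x) + (length (map viaDescent (mf x)) + length (concatMap childCharges bad))
      ≡⟨ cong (λ l → length (mf x) + (l + length (concatMap childCharges bad)))
              (length-map viaDescent (mf x)) ⟩
    length (mf x) + (length (mf x) + length (concatMap childCharges bad))
      ≤⟨ +-mono-≤ (mf≤s x) (+-mono-≤ (mf≤s x) (length-concatMap-≤ childCharges childCharges≤s bad)) ⟩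
    s + (s + length bad * s)
      ≤⟨ +-monoʳ-≤ s (+-monoʳ-≤ s (*-monoˡ-≤ s bad≤k)) ⟩
    s + (s + k * s)
      ≡⟨ trans (sym (+-assoc s s (k * s))) (+-comm (s + s) (k * s)) ⟩
    k * s + (s + s)
      ≤⟨ +-monoʳ-≤ (k * s) (+-monoʳ-≤ s (m≤m+n s (s + 0))) ⟩
    k * s + 3 * s ∎
    where
    open ≤-Reasoning
    childCharges≤s : ∀ y → length (childCharges y) ≤ s
    childCharges≤s y = ≤-trans (≤-reflexive (length-map (viaChild y) (mf y))) (mf≤s y)

-- The goal is decidable, hence stable under double negation; this licenses the classical steps
-- (maximal factors, least indices, case distinctions) taken in the ¬¬ monad.
lemma58 : ∀ {n m : ℕ} (H : Hypergraph n) (t : TreeDec H m) (F : ElimForest H)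
          (x : Fin m) (mir split : ℕ) → IsMir t F mir → IsSplit t F split →
          (L : List (Subset n)) → Unique L → All (CountedCtx t F x) L →
          length L ≤ mir * split + 3 * split
lemma58 {n} {m} H t F x mir split (bad-children , _) (mf-sizes , _) L L-unique counted =
  decidable-stable (length L ≤? mir * split + 3 * split) do
    covered ← All.mapM 0ℓ ¬¬-Monad counted-charged counted
    pure (≤-trans (length-≤-of-injective-cover Charged Charged-injective charges L-unique covered)
                  (charges-length (proj₂ (proj₂ bad-cover)) (proj₂ ∘ proj₂ ∘ mf-cover)))
  where
  mf-cover : ∀ y → Σ (List (Subset n)) λ As →
             (∀ A → InMF (fpar F) (cmp t y) A → A ∈ₗ As) × length As ≤ split
  mf-cover y = let _ , card , k≤split = mf-sizes y in bounded-cover card k≤split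

  bad-cover : Σ (List (Fin m)) λ ys → (∀ y → NonWFChild t F x y → y ∈ₗ ys) × length ys ≤ mir
  bad-cover = let _ , card , k≤mir = bad-children x in bounded-cover card k≤mir

  open Charging t F x (proj₁ ∘ mf-cover) (proj₁ ∘ proj₂ ∘ mf-cover)
                      (proj₁ bad-cover) (proj₁ (proj₂ bad-cover))
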